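{- Let $n \geq 1$ and let $\mathsf{Tchouk}_n = (b_1,\ldots,b_\ell)$, where $\ell$ is the largest index with $b_\ell \neq 0$. Then $b_\ell = \ell$.
   Context: Tchoukaillon solitaire: a board consists of a pit (hole $0$) followed by holes $1,2,3,\ldots$; a configuration $c=(c_1,c_2,\ldots)$ records the number $c_i$ of stones in hole $i$ (the pit is not recorded). A move selects a hole $i$ containing $s_i$ stones, removes them, and puts one stone in each of holes $i-1,i-2,\ldots,i-s_i$ (the move is illegal, and the game lost, if $s_i > i$). The game is won if all stones reach the pit. For each $n\ge 0$ there is a unique winning configuration with $n$ stones, denoted $\mathsf{Tchouk}_n$; explicitly $\mathsf{Tchouk}_0 = ()$ and for $n\geq 1$, $\mathsf{Tchouk}_n = (c_1,\ldots,c_\ell)$ where $c_1 = n \bmod 2$ and $c_k = \bigl(n-(c_1+\cdots+c_{k-1})\bigr) \bmod (k+1)$, stopping at the first $\ell$ with $c_1+\cdots+c_\ell = n$. Equivalently, $\mathsf{Tchouk}_1=(1)$ and $\mathsf{Tchouk}_{n}$ is obtained from $\mathsf{Tchouk}_{n-1}$ by taking the smallest index $i\ge1$ with hole $i$ empty, putting $i$ stones in hole $i$, and removing one stone from each of holes $1,\ldots,i-1$. -}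

module Defs where

open import Data.Nat using (ℕ; zero; suc; _∸_)
open import Data.List using (List; []; _∷_; length)
open import Data.Maybe using (Maybe; just; nothing)

-- A configuration is a finite list (c₁, c₂, …, c_m) of stone counts of holes 1..m;
-- holes beyond the list are empty.
Config : Set
Config = List ℕ

-- One step Tchouk_{n-1} ↦ Tchouk_n: find the smallest hole i ≥ 1 that is empty,
-- put i stones in it, remove one stone from each of holes 1..i-1.
-- `step i c` processes the configuration starting at hole index i.
step : ℕ → Config → Config
step i []            = i ∷ []
step i (zero ∷ cs)   = i ∷ cs
step i (suc c ∷ cs)  = c ∷ step (suc i) cs

Tchouk : ℕ → Config
Tchouk zero    = []
Tchouk (suc n) = step 1 (Tchouk n)

hole : Config → ℕ → ℕ
hole []       _             = 0
hole (c ∷ cs) zero          = 0   -- index 0 is the pit, not recorded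
hole (c ∷ cs) (suc zero)    = c
hole (c ∷ cs) (suc (suc k)) = hole cs (suc k)

{-# OPTIONS --safe #-}
module Submission where

-- Read a configuration as starting at some hole i. The invariant "the last entry of the
-- list equals its own hole index" holds for the empty board and is preserved by a step:
-- the step either fills an empty hole strictly inside the list (the last entry is
-- untouched), fills the hole just past the end with as many stones as its index, or
-- recurses into the tail one hole further on. Starting from hole 1, the last entry is the
-- last nonzero hole, so it equals its index.

open import Defs
open import Data.Nat using (ℕ; zero; suc; _<_; _≥_; _+_; s≤s; z≤n)
open import Data.Nat.Properties using (+-comm; +-suc)
open import Data.List using ([]; _∷_)
open import Data.Product using (∃; _,_)
open import Data.Empty using (⊥-elim)
open import Relation.Binary.PropositionalEquality using (_≡_; _≢_; refl; sym; trans)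

data LastIsIndex : ℕ → Config → Set where
  empty  : ∀ {i} → LastIsIndex i []
  single : ∀ {i} → LastIsIndex i (i ∷ [])
  cons   : ∀ {i x y ys} → LastIsIndex (suc i) (y ∷ ys) → LastIsIndex i (x ∷ y ∷ ys)

step-LastIsIndex : ∀ i c → LastIsIndex i c → LastIsIndex i (step i c)
step-LastIsIndex i []                  empty    = single
step-LastIsIndex i (zero ∷ [])         single   = single
step-LastIsIndex i (zero ∷ y ∷ ys)     (cons p) = cons p
step-LastIsIndex i (suc c ∷ [])        single   = cons single
step-LastIsIndex i (suc c ∷ zero ∷ ys) (cons p) = cons (step-LastIsIndex (suc i) (zero ∷ ys) p)
step-LastIsIndex i (suc c ∷ suc y ∷ ys) (cons p) =
  cons (step-LastIsIndex (suc i) (suc y ∷ ys) p)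

Tchouk-LastIsIndex : ∀ n → LastIsIndex 1 (Tchouk n)
Tchouk-LastIsIndex zero    = empty
Tchouk-LastIsIndex (suc n) = step-LastIsIndex 1 (Tchouk n) (Tchouk-LastIsIndex n)

nonempty-LastIsIndex⇒hole≢0 : ∀ {i y ys} → LastIsIndex (suc i) (y ∷ ys) →
                              ∃ λ k → hole (y ∷ ys) (suc k) ≢ 0
nonempty-LastIsIndex⇒hole≢0 single   = 0 , λ ()
nonempty-LastIsIndex⇒hole≢0 (cons p) with nonempty-LastIsIndex⇒hole≢0 p
... | k , hole≢0 = suc k , hole≢0

-- With the list starting at hole suc j, the entry in its ℓ-th position sits in hole j + ℓ.
LastIsIndex⇒lastNonzeroHole≡index :
  ∀ j c → LastIsIndex (suc j) c → ∀ ℓ → hole c ℓ ≢ 0 →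
  ((k : ℕ) → ℓ < k → hole c k ≡ 0) → hole c ℓ ≡ j + ℓ
LastIsIndex⇒lastNonzeroHole≡index j [] empty ℓ ℓ≢0 _ = ⊥-elim (ℓ≢0 refl)
LastIsIndex⇒lastNonzeroHole≡index j (_ ∷ []) single (suc zero) _ _ = sym (+-comm j 1)
LastIsIndex⇒lastNonzeroHole≡index j (_ ∷ []) single zero ℓ≢0 _ = ⊥-elim (ℓ≢0 refl)
LastIsIndex⇒lastNonzeroHole≡index j (_ ∷ []) single (suc (suc _)) ℓ≢0 _ = ⊥-elim (ℓ≢0 refl)
LastIsIndex⇒lastNonzeroHole≡index j (_ ∷ _ ∷ _) (cons _) zero ℓ≢0 _ = ⊥-elim (ℓ≢0 refl)
LastIsIndex⇒lastNonzeroHole≡index j (_ ∷ _ ∷ _) (cons p) (suc zero) _ beyond≡0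
  with nonempty-LastIsIndex⇒hole≢0 p
... | k , hole≢0 = ⊥-elim (hole≢0 (beyond≡0 (suc (suc k)) (s≤s (s≤s z≤n))))
LastIsIndex⇒lastNonzeroHole≡index j (_ ∷ y ∷ ys) (cons p) (suc (suc m)) ℓ≢0 beyond≡0 =
  trans (LastIsIndex⇒lastNonzeroHole≡index (suc j) (y ∷ ys) p (suc m) ℓ≢0 tail-beyond≡0)
        (sym (+-suc j (suc m)))
  where
  tail-beyond≡0 : (k : ℕ) → suc m < k → hole (y ∷ ys) k ≡ 0
  tail-beyond≡0 (suc k) m<k = beyond≡0 (suc (suc k)) (s≤s m<k)

lemma3p4 : (n ℓ : ℕ) → n ≥ 1 →
           hole (Tchouk n) ℓ ≢ 0 →
           ((k : ℕ) → ℓ < k → hole (Tchouk n) k ≡ 0) →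
           hole (Tchouk n) ℓ ≡ ℓ
lemma3p4 n ℓ _ =
  LastIsIndex⇒lastNonzeroHole≡index 0 (Tchouk n) (Tchouk-LastIsIndex n) ℓ
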